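{- Work in $\mathrm{FOL}(=,\in)$ without Extensionality, in the theory with the following six axioms: 1. (Complements) $\forall A\,\exists x\,\forall y\,(y\in x\Leftrightarrow y\notin A)$; 2. (Pairing) $\forall a,b\,\exists x\,\forall y\,(y\in x\Leftrightarrow y=a\vee y=b)$; 3. (Set union) $\forall A\,\exists x\,\forall y\,(y\in x\Leftrightarrow \exists m\,(m\in A\wedge y\in m))$; 4. (Frege $1^*$) $\exists x\,\forall y\,(y\in x\Leftrightarrow \exists z\,\forall m\,(m\in y\Rightarrow m=z))$; 5. (Preproduct) $\forall R,S\,\exists x\,\forall y\,(y\in x\Leftrightarrow \exists r\,\exists s\,(r\in R\wedge s\in S\wedge \forall z\,(z\in y\Rightarrow z\in s\vee z\in r)))$; 6. (Unordered intersection relation set) $\exists x\,\forall y\,(y\in x\Leftrightarrow \exists z\,\forall m\,(m\in y\Rightarrow z\in m))$. Then this theory proves the Composition (unordered relative products) axiom $\forall R,S\,\exists X\,\forall y\,(y\in X\Leftrightarrow \exists a,b,c,r,s\,(\mathrm{pair}(y,a,c)\wedge r\in R\wedge s\in S\wedge \mathrm{pair}(r,a,b)\wedge \mathrm{pair}(s,b,c)))$.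
   Context: $\mathrm{pair}(x,a,b)$ abbreviates $\forall y\,(y\in x\Leftrightarrow y=a\vee y=b)$. Extensionality is not assumed. -}

module Defs where

open import Data.Product using (Σ; ∃; ∃-syntax; _×_)
open import Data.Sum using (_⊎_)
open import Relation.Nullary using (¬_)
open import Relation.Binary.PropositionalEquality using (_≡_)
open import Function.Bundles using (_⇔_)

ExcludedMiddle : Set₁
ExcludedMiddle = (P : Set) → P ⊎ ¬ P

-- A structure for FOL(=,∈): a domain M and a membership relation.
-- Equality is interpreted as identity (_≡_); extensionality is NOT assumed.
module _ {M : Set} (_∈_ : M → M → Set) where

  pair : M → M → M → Set
  pair x a b = ∀ y → (y ∈ x) ⇔ (y ≡ a ⊎ y ≡ b)

  Complements : Set
  Complements = ∀ A → ∃[ x ] ∀ y → (y ∈ x) ⇔ (¬ (y ∈ A))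

  Pairing : Set
  Pairing = ∀ a b → ∃[ x ] pair x a b

  SetUnion : Set
  SetUnion = ∀ A → ∃[ x ] ∀ y → (y ∈ x) ⇔ (∃[ m ] (m ∈ A × y ∈ m))

  Frege1* : Set
  Frege1* = ∃[ x ] ∀ y → (y ∈ x) ⇔ (∃[ z ] ∀ m → m ∈ y → m ≡ z)

  Preproduct : Set
  Preproduct = ∀ R S → ∃[ x ] ∀ y → (y ∈ x) ⇔
    (∃[ r ] ∃[ s ] (r ∈ R × s ∈ S × (∀ z → z ∈ y → z ∈ s ⊎ z ∈ r)))

  IntersectionRelSet : Set
  IntersectionRelSet = ∃[ x ] ∀ y → (y ∈ x) ⇔ (∃[ z ] ∀ m → m ∈ y → z ∈ m)

  Composition : Set
  Composition = ∀ R S → ∃[ X ] ∀ y → (y ∈ X) ⇔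
    (∃[ a ] ∃[ b ] ∃[ c ] ∃[ r ] ∃[ s ]
      (pair y a c × r ∈ R × s ∈ S × pair r a b × pair s b c))

{-# OPTIONS --safe #-}
-- Classically, the classes that are sets are closed under complement, union, intersection, ⋃,
-- preproducts, "subset of some member of A", "all members in A" and "some member in A", and they
-- include the sets with at most one member (Frege 1*), with at most two members, and whose members
-- have a common element (axiom 6).
-- Let y = {a, c}, r = {a, b} ∈ R and s = {b, c} ∈ S. If a, b, c are distinct, {y, r, s} is a
-- triangle: three sets with at most two members that pairwise meet but have no common element, a
-- configuration these operations can describe, so y is found as a vertex of a triangle whose other
-- vertices lie in R and S. Restricting that vertex to a cell of the partition generated by R and S
-- makes the converse work whichever vertex y is. In the degenerate cases a = c, a = b and, by the
-- symmetry R ↔ S, b = c, y has the same members as a set of a simpler shape; without extensionality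
-- this is expressed through subsets, which suffices because these sets have at most two members.
module Submission where

open import Defs
open import Data.Bool using (Bool; true; false)
open import Data.Empty using (⊥; ⊥-elim)
open import Data.Product using (∃; ∃-syntax; _×_; _,_; proj₁; proj₂)
open import Data.Sum using (_⊎_; inj₁; inj₂; [_,_]′; swap; reduce)
open import Function.Base using (_∘_; id)
open import Function.Bundles using (_⇔_; mk⇔; Equivalence)
open import Function.Properties.Equivalence using () renaming (sym to ⇔-sym; trans to ⇔-trans)
open import Relation.Nullary using (¬_)
open import Relation.Unary using (∅; ∁; _∩_; _∪_)
open import Relation.Binary.PropositionalEquality using (_≡_; refl; sym; trans; subst)

Literal : Bool → Set → Set
Literal true P = P
Literal false P = ¬ P

literal : ExcludedMiddle → ∀ P → ∃[ i ] Literal i P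
literal em P with em P
... | inj₁ p = true , p
... | inj₂ ¬p = false , ¬p

literal-transfer : ∀ {i P Q} → Literal i P → Literal i Q → P → Q
literal-transfer {true} _ q _ = q
literal-transfer {false} ¬p _ p = ⊥-elim (¬p p)

module Classes {M : Set} (_∈_ : M → M → Set) where

  private variable
    P Q : M → Set
    a b c g r s u v w x y z W : M

  IsSet : (M → Set) → Set
  IsSet P = ∃[ x ] ∀ y → y ∈ x ⇔ P y

  set : IsSet P → M
  set = proj₁

  ∈-set⁻ : (A : IsSet P) → y ∈ set A → P y
  ∈-set⁻ (_ , A) = Equivalence.to (A _)

  ∈-set⁺ : (A : IsSet P) → P y → y ∈ set A
  ∈-set⁺ (_ , A) = Equivalence.from (A _)

  IsSet-resp : (∀ {y} → P y → Q y) → (∀ {y} → Q y → P y) → IsSet P → IsSet Q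
  IsSet-resp f g A = set A , λ _ → mk⇔ (f ∘ ∈-set⁻ A) (∈-set⁺ A ∘ g)

  isSet-∈ : ∀ x → IsSet (_∈ x)
  isSet-∈ x = x , λ _ → mk⇔ id id

  _⊆_ : M → M → Set
  x ⊆ y = ∀ z → z ∈ x → z ∈ y

  _≈_ : M → M → Set
  x ≈ y = ∀ z → z ∈ x ⇔ z ∈ y

  ≈-sym : x ≈ y → y ≈ x
  ≈-sym x≈y z = ⇔-sym (x≈y z)

  ≈⇒⊆ : x ≈ y → x ⊆ y
  ≈⇒⊆ x≈y z = Equivalence.to (x≈y z)

  ⊆-antisym : x ⊆ y → y ⊆ x → x ≈ y
  ⊆-antisym x⊆y y⊆x z = mk⇔ (x⊆y z) (y⊆x z)

  All : (M → Set) → M → Set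
  All P x = ∀ z → z ∈ x → P z

  Any : (M → Set) → M → Set
  Any P x = ∃[ z ] (z ∈ x × P z)

  Inhabited : M → Set
  Inhabited x = ∃[ z ] z ∈ x

  _meets_ : M → M → Set
  x meets y = ∃[ z ] (z ∈ x × z ∈ y)

  AtMostOne : M → Set
  AtMostOne x = ∃[ z ] ∀ m → m ∈ x → m ≡ z

  AtMostTwo : M → Set
  AtMostTwo x = ∃[ p ] ∃[ q ] ∀ z → z ∈ x → z ≡ p ⊎ z ≡ q

  HasCommonElement : M → Set
  HasCommonElement x = ∃[ z ] ∀ m → m ∈ x → z ∈ m

  CoveredBy : (M → Set) → (M → Set) → M → Set
  CoveredBy P Q y = ∃[ r ] ∃[ s ] (P r × Q s × (∀ z → z ∈ y → z ∈ s ⊎ z ∈ r))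

  SubsetOf : (M → Set) → M → Set
  SubsetOf P y = ∃[ a ] (P a × y ⊆ a)

  Saturation : (M → Set) → M → Set
  Saturation P y = ∃[ a ] (P a × y ≈ a)

  MeetsSome : (M → Set) → M → Set
  MeetsSome P y = ∃[ b ] (P b × y meets b)

  OneOf : M → M → M → M → Set
  OneOf g r s x = x ≡ g ⊎ x ≡ r ⊎ x ≡ s

  WithinOne : (M → Set) → M → Set
  WithinOne P v = ∃[ z ] (P z × All (_≡ z) v)

  WithinTriple : (M → Set) → (M → Set) → (M → Set) → M → Set
  WithinTriple P Q T W = ∃[ g ] ∃[ r ] ∃[ s ] (P g × Q r × T s × All (OneOf g r s) W)

  -- For W with exactly three members this says that two of them are disjoint.
  DisjointSplit : M → Set
  DisjointSplit = CoveredBy (AtMostTwo ∩ ∁ HasCommonElement) AtMostOne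

  oneOf-elim : P g → P r → P s → OneOf g r s x → P x
  oneOf-elim Pg _ _ (inj₁ refl) = Pg
  oneOf-elim _ Pr _ (inj₂ (inj₁ refl)) = Pr
  oneOf-elim _ _ Ps (inj₂ (inj₂ refl)) = Ps

  oneOf-rotate : OneOf g r s x → OneOf r s g x
  oneOf-rotate (inj₁ x≡g) = inj₂ (inj₂ x≡g)
  oneOf-rotate (inj₂ (inj₁ x≡r)) = inj₁ x≡r
  oneOf-rotate (inj₂ (inj₂ x≡s)) = inj₂ (inj₁ x≡s)

  Pair : M → M → M → Set
  Pair = pair _∈_

  pair-∈ˡ : Pair x a b → a ∈ x
  pair-∈ˡ x-ab = Equivalence.from (x-ab _) (inj₁ refl)

  pair-∈ʳ : Pair x a b → b ∈ x
  pair-∈ʳ x-ab = Equivalence.from (x-ab _) (inj₂ refl)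

  pair-∈⁻ : Pair x a b → y ∈ x → y ≡ a ⊎ y ≡ b
  pair-∈⁻ x-ab = Equivalence.to (x-ab _)

  pair-intro : a ∈ x → b ∈ x → All (λ y → y ≡ a ⊎ y ≡ b) x → Pair x a b
  pair-intro a∈x b∈x x⊆ab y = mk⇔ (x⊆ab y) [ (λ { refl → a∈x }) , (λ { refl → b∈x }) ]′

  pair-sym : Pair x a b → Pair x b a
  pair-sym x-ab y = ⇔-trans (x-ab y) (mk⇔ swap swap)

  pair-resp-≈ : x ≈ y → Pair x a b → Pair y a b
  pair-resp-≈ x≈y x-ab z = ⇔-trans (⇔-sym (x≈y z)) (x-ab z)

  pair-≈ : Pair x a b → Pair y a b → x ≈ y
  pair-≈ x-ab y-ab z = ⇔-trans (x-ab z) (⇔-sym (y-ab z))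

  pair-⊆ : Pair x a b → a ∈ y → b ∈ y → x ⊆ y
  pair-⊆ x-ab a∈y b∈y z z∈x =
    [ (λ { refl → a∈y }) , (λ { refl → b∈y }) ]′ (pair-∈⁻ x-ab z∈x)

  pair-∉ : Pair x a b → ¬ z ≡ a → ¬ z ≡ b → ¬ z ∈ x
  pair-∉ x-ab z≢a z≢b z∈x = [ z≢a , z≢b ]′ (pair-∈⁻ x-ab z∈x)

  ∈∉⇒≢ : z ∈ x → ¬ z ∈ y → ¬ x ≡ y
  ∈∉⇒≢ z∈x z∉y refl = z∉y z∈x

  pair⇒atMostTwo : Pair x a b → AtMostTwo x
  pair⇒atMostTwo x-ab = _ , _ , λ _ → pair-∈⁻ x-ab

  pair⇒atMostOne : Pair x a a → AtMostOne x
  pair⇒atMostOne x-aa = _ , λ _ → reduce ∘ pair-∈⁻ x-aa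

  atMostOne⇒pair : AtMostOne x → a ∈ x → Pair x a a
  atMostOne⇒pair (_ , x⊆z) a∈x =
    pair-intro a∈x a∈x λ y y∈x → inj₁ (trans (x⊆z y y∈x) (sym (x⊆z _ a∈x)))

  atMostTwo⇒pair : AtMostTwo x → a ∈ x → b ∈ x → ¬ a ≡ b → Pair x a b
  atMostTwo⇒pair {a = a} {b = b} (p , q , x⊆pq) a∈x b∈x a≢b =
    pair-intro a∈x b∈x λ y y∈x → relabel (x⊆pq _ a∈x) (x⊆pq _ b∈x) (x⊆pq y y∈x)
    where
      relabel : a ≡ p ⊎ a ≡ q → b ≡ p ⊎ b ≡ q → y ≡ p ⊎ y ≡ q → y ≡ a ⊎ y ≡ b
      relabel (inj₁ refl) (inj₁ refl) _ = ⊥-elim (a≢b refl)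
      relabel (inj₂ refl) (inj₂ refl) _ = ⊥-elim (a≢b refl)
      relabel (inj₁ refl) (inj₂ refl) y∈ab = y∈ab
      relabel (inj₂ refl) (inj₁ refl) y∈ba = swap y∈ba

  atMostOne-⊆ : y ⊆ x → AtMostOne x → AtMostOne y
  atMostOne-⊆ y⊆x (z , x⊆z) = z , λ m m∈y → x⊆z m (y⊆x m m∈y)

  inhabited-⊆ : x ⊆ y → Inhabited x → Inhabited y
  inhabited-⊆ x⊆y (z , z∈x) = z , x⊆y z z∈x

  atMostOne-⊇ : AtMostOne x → y ⊆ x → Inhabited y → x ⊆ y
  atMostOne-⊇ (_ , x⊆z) y⊆x (w , w∈y) t t∈x =
    subst (_∈ _) (trans (x⊆z w (y⊆x w w∈y)) (sym (x⊆z t t∈x))) w∈y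

  pair-hasCommonElement : Pair x a b → HasCommonElement x ⇔ a meets b
  pair-hasCommonElement x-ab = mk⇔
    (λ (z , z∈all) → z , z∈all _ (pair-∈ˡ x-ab) , z∈all _ (pair-∈ʳ x-ab))
    (λ (z , z∈a , z∈b) → z , λ m m∈x →
       [ (λ { refl → z∈a }) , (λ { refl → z∈b }) ]′ (pair-∈⁻ x-ab m∈x))

  pairwiseMeeting⇒¬disjointSplit : u ∈ W → v ∈ W → w ∈ W → ¬ u ≡ v → ¬ v ≡ w → ¬ u ≡ w →
    u meets v → v meets w → u meets w → ¬ DisjointSplit W
  pairwiseMeeting⇒¬disjointSplit {u = u} {v = v} {w = w} u∈W v∈W w∈W u≢v v≢w u≢w uv vw uw
    (Y , m , (Y₂ , ¬common) , m₁ , W⊆mY) = separate (W⊆mY u u∈W) (W⊆mY v v∈W) (W⊆mY w w∈W)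
    where
      bothIn-m : ∀ {x y} → x ∈ m → y ∈ m → ¬ x ≡ y → ⊥
      bothIn-m x∈m y∈m x≢y = x≢y (trans (proj₂ m₁ _ x∈m) (sym (proj₂ m₁ _ y∈m)))
      bothIn-Y : ∀ {x y} → x ∈ Y → y ∈ Y → ¬ x ≡ y → x meets y → ⊥
      bothIn-Y x∈Y y∈Y x≢y =
        ¬common ∘ Equivalence.from (pair-hasCommonElement (atMostTwo⇒pair Y₂ x∈Y y∈Y x≢y))
      separate : u ∈ m ⊎ u ∈ Y → v ∈ m ⊎ v ∈ Y → w ∈ m ⊎ w ∈ Y → ⊥
      separate (inj₁ u∈m) (inj₁ v∈m) _ = bothIn-m u∈m v∈m u≢v
      separate (inj₁ u∈m) (inj₂ _) (inj₁ w∈m) = bothIn-m u∈m w∈m u≢w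
      separate (inj₂ _) (inj₁ v∈m) (inj₁ w∈m) = bothIn-m v∈m w∈m v≢w
      separate (inj₁ _) (inj₂ v∈Y) (inj₂ w∈Y) = bothIn-Y v∈Y w∈Y v≢w vw
      separate (inj₂ u∈Y) (inj₁ _) (inj₂ w∈Y) = bothIn-Y u∈Y w∈Y u≢w uw
      separate (inj₂ u∈Y) (inj₂ v∈Y) _ = bothIn-Y u∈Y v∈Y u≢v uv

  triangle : AtMostTwo g → AtMostTwo r → AtMostTwo s → (∀ z → z ∈ g → z ∈ r → z ∈ s → ⊥) →
    g meets r → r meets s → s meets g → ∃[ a ] ∃[ b ] ∃[ c ] (Pair g a c × Pair r a b × Pair s b c)
  triangle g₂ r₂ s₂ noCommon (a , a∈g , a∈r) (b , b∈r , b∈s) (c , c∈s , c∈g) =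
    a , b , c , atMostTwo⇒pair g₂ a∈g c∈g a≢c , atMostTwo⇒pair r₂ a∈r b∈r a≢b ,
    atMostTwo⇒pair s₂ b∈s c∈s b≢c
    where
      a≢b : ¬ a ≡ b
      a≢b refl = noCommon a a∈g a∈r b∈s
      b≢c : ¬ b ≡ c
      b≢c refl = noCommon b c∈g b∈r b∈s
      a≢c : ¬ a ≡ c
      a≢c refl = noCommon a a∈g a∈r c∈s

  triangle-¬common : Pair g a c → Pair r a b → Pair s b c → ¬ a ≡ b → ¬ b ≡ c → ¬ a ≡ c →
    z ∈ g → z ∈ r → z ∈ s → ⊥
  triangle-¬common {a = a} {c = c} {b = b} {z = z} g-ac r-ab s-bc a≢b b≢c a≢c z∈g z∈r z∈s =
    noCommon (pair-∈⁻ g-ac z∈g) (pair-∈⁻ r-ab z∈r) (pair-∈⁻ s-bc z∈s)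
    where
      noCommon : z ≡ a ⊎ z ≡ c → z ≡ a ⊎ z ≡ b → z ≡ b ⊎ z ≡ c → ⊥
      noCommon (inj₁ refl) _ (inj₁ refl) = a≢b refl
      noCommon (inj₁ refl) _ (inj₂ refl) = a≢c refl
      noCommon (inj₂ refl) (inj₁ refl) _ = a≢c refl
      noCommon (inj₂ refl) (inj₂ refl) _ = b≢c refl

module Classical (em : ExcludedMiddle) {M : Set} (_∈_ : M → M → Set) where
  open Classes _∈_

  private variable
    a x y : M

  dne : {P : Set} → ¬ ¬ P → P
  dne {P} ¬¬p = [ id , ⊥-elim ∘ ¬¬p ]′ (em P)

  completePair : AtMostTwo x → a ∈ x → ∃[ b ] Pair x a b
  completePair {x} {a} x₂ a∈x with em (∃[ b ] (b ∈ x × ¬ b ≡ a))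
  ... | inj₁ (b , b∈x , b≢a) = b , atMostTwo⇒pair x₂ a∈x b∈x (b≢a ∘ sym)
  ... | inj₂ ¬other = a , atMostOne⇒pair (a , λ y y∈x → dne λ y≢a → ¬other (y , y∈x , y≢a)) a∈x

  atMostTwo-⊇ : AtMostTwo x → y ⊆ x → ¬ AtMostOne y → x ⊆ y
  atMostTwo-⊇ {x} {y} (p , q , x⊆pq) y⊆x ¬y₁ t t∈x = dne λ t∉y → ¬y₁ (other (x⊆pq t t∈x) t∉y)
    where
      avoid : ∀ {t u m} → ¬ t ∈ y → m ∈ y → m ≡ t ⊎ m ≡ u → m ≡ u
      avoid t∉y m∈y (inj₁ refl) = ⊥-elim (t∉y m∈y)
      avoid _ _ (inj₂ m≡u) = m≡u
      other : ∀ {t} → t ≡ p ⊎ t ≡ q → ¬ t ∈ y → AtMostOne y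
      other (inj₁ refl) t∉y = q , λ m m∈y → avoid t∉y m∈y (x⊆pq m (y⊆x m m∈y))
      other (inj₂ refl) t∉y = p , λ m m∈y → avoid t∉y m∈y (swap (x⊆pq m (y⊆x m m∈y)))

module BooleanClosure (em : ExcludedMiddle) {M : Set} (_∈_ : M → M → Set)
  (complements : Complements _∈_) (pairing : Pairing _∈_) (setUnion : SetUnion _∈_) where
  open Classes _∈_
  open Classical em _∈_

  private variable
    P Q : M → Set

  ∁-set : IsSet P → IsSet (∁ P)
  ∁-set A = IsSet-resp (λ y∉A → y∉A ∘ ∈-set⁺ A) (λ ¬Py → ¬Py ∘ ∈-set⁻ A)
    (complements (set A))

  pair-set : ∀ a b → IsSet (λ y → y ≡ a ⊎ y ≡ b)
  pair-set = pairing

  singleton-set : ∀ a → IsSet (_≡ a)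
  singleton-set a = IsSet-resp reduce inj₁ (pair-set a a)

  ⋃-set : IsSet P → IsSet (λ y → ∃[ m ] (P m × y ∈ m))
  ⋃-set A = IsSet-resp (λ (m , m∈A , y∈m) → m , ∈-set⁻ A m∈A , y∈m)
                       (λ (m , Pm , y∈m) → m , ∈-set⁺ A Pm , y∈m)
                       (setUnion (set A))

  ∪-set : IsSet P → IsSet Q → IsSet (P ∪ Q)
  ∪-set {P} {Q} A B = IsSet-resp from-⋃ to-⋃ (⋃-set (pair-set (set A) (set B)))
    where
      from-⋃ : ∀ {y} → ∃[ m ] ((m ≡ set A ⊎ m ≡ set B) × y ∈ m) → P y ⊎ Q y
      from-⋃ (_ , inj₁ refl , y∈A) = inj₁ (∈-set⁻ A y∈A)
      from-⋃ (_ , inj₂ refl , y∈B) = inj₂ (∈-set⁻ B y∈B)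
      to-⋃ : ∀ {y} → P y ⊎ Q y → ∃[ m ] ((m ≡ set A ⊎ m ≡ set B) × y ∈ m)
      to-⋃ (inj₁ Py) = set A , inj₁ refl , ∈-set⁺ A Py
      to-⋃ (inj₂ Qy) = set B , inj₂ refl , ∈-set⁺ B Qy

  ∩-set : IsSet P → IsSet Q → IsSet (P ∩ Q)
  ∩-set {P} {Q} A B = IsSet-resp from-∁∪ to-∁∪ (∁-set (∪-set (∁-set A) (∁-set B)))
    where
      from-∁∪ : ∀ {y} → ¬ (¬ P y ⊎ ¬ Q y) → P y × Q y
      from-∁∪ h = dne (h ∘ inj₁) , dne (h ∘ inj₂)
      to-∁∪ : ∀ {y} → P y × Q y → ¬ (¬ P y ⊎ ¬ Q y)
      to-∁∪ (Py , Qy) = [ (λ ¬Py → ¬Py Py) , (λ ¬Qy → ¬Qy Qy) ]′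

  -- The argument only witnesses that M is inhabited.
  ∅-set : M → IsSet ∅
  ∅-set x = IsSet-resp (λ h → h (inj₂ (h ∘ inj₁))) ⊥-elim
    (∁-set (∪-set (isSet-∈ x) (∁-set (isSet-∈ x))))

  oneOf-set : ∀ g r s → IsSet (OneOf g r s)
  oneOf-set g r s = ∪-set (singleton-set g) (pair-set r s)

  oneOf⇒∈singleton⊎∈pair : ∀ {g r s x} → OneOf g r s x →
    x ∈ set (singleton-set s) ⊎ x ∈ set (pair-set g r)
  oneOf⇒∈singleton⊎∈pair (inj₁ x≡g) = inj₂ (∈-set⁺ (pair-set _ _) (inj₁ x≡g))
  oneOf⇒∈singleton⊎∈pair (inj₂ (inj₁ x≡r)) = inj₂ (∈-set⁺ (pair-set _ _) (inj₂ x≡r))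
  oneOf⇒∈singleton⊎∈pair (inj₂ (inj₂ x≡s)) = inj₁ (∈-set⁺ (singleton-set _) x≡s)

  literal-set : ∀ i x → IsSet (λ y → Literal i (y ∈ x))
  literal-set true x = isSet-∈ x
  literal-set false x = complements x

  ∃Bool-set : {P : Bool → M → Set} → (∀ i → IsSet (P i)) → IsSet (λ y → ∃[ i ] P i y)
  ∃Bool-set {P} A = IsSet-resp from-∪ to-∪ (∪-set (A true) (A false))
    where
      from-∪ : ∀ {y} → P true y ⊎ P false y → ∃[ i ] P i y
      from-∪ = [ (true ,_) , (false ,_) ]′
      to-∪ : ∀ {y} → ∃[ i ] P i y → P true y ⊎ P false y
      to-∪ (true , p) = inj₁ p
      to-∪ (false , p) = inj₂ p

module PreproductClosure (em : ExcludedMiddle) {M : Set} (_∈_ : M → M → Set)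
  (complements : Complements _∈_) (pairing : Pairing _∈_) (setUnion : SetUnion _∈_)
  (preproduct : Preproduct _∈_) where
  open Classes _∈_
  open Classical em _∈_
  open BooleanClosure em _∈_ complements pairing setUnion

  private variable
    P Q : M → Set

  coveredBy-set : IsSet P → IsSet Q → IsSet (CoveredBy P Q)
  coveredBy-set A B =
    IsSet-resp (λ (r , s , r∈A , s∈B , y⊆sr) → r , s , ∈-set⁻ A r∈A , ∈-set⁻ B s∈B , y⊆sr)
               (λ (r , s , Pr , Qs , y⊆sr) → r , s , ∈-set⁺ A Pr , ∈-set⁺ B Qs , y⊆sr)
               (preproduct (set A) (set B))

  subsetOf-set : IsSet P → IsSet (SubsetOf P)
  subsetOf-set {P} A = IsSet-resp from-covered to-covered (coveredBy-set A (singleton-set ∅₀))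
    where
      ∅₀ : M
      ∅₀ = set (∅-set (set A))
      from-covered : ∀ {y} → CoveredBy P (_≡ ∅₀) y → SubsetOf P y
      from-covered (a , _ , Pa , refl , y⊆∅a) =
        a , Pa , λ z z∈y → [ ⊥-elim ∘ ∈-set⁻ (∅-set (set A)) , id ]′ (y⊆∅a z z∈y)
      to-covered : ∀ {y} → SubsetOf P y → CoveredBy P (_≡ ∅₀) y
      to-covered (a , Pa , y⊆a) = a , ∅₀ , Pa , refl , λ z z∈y → inj₂ (y⊆a z z∈y)

  all-set : IsSet P → IsSet (All P)
  all-set {P} A = IsSet-resp from-subset to-subset (subsetOf-set (singleton-set (set A)))
    where
      from-subset : ∀ {y} → SubsetOf (_≡ set A) y → All P y
      from-subset (_ , refl , y⊆A) z z∈y = ∈-set⁻ A (y⊆A z z∈y)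
      to-subset : ∀ {y} → All P y → SubsetOf (_≡ set A) y
      to-subset y⊆P = set A , refl , λ z z∈y → ∈-set⁺ A (y⊆P z z∈y)

  any-set : IsSet P → IsSet (Any P)
  any-set {P} A = IsSet-resp (λ ¬all → dne λ ¬any → ¬all λ z z∈y Pz → ¬any (z , z∈y , Pz))
                             (λ (z , z∈y , Pz) all → all z z∈y Pz)
                             (∁-set (all-set (∁-set A)))

  inhabited-set : M → IsSet Inhabited
  inhabited-set x = IsSet-resp (λ ¬empty → dne λ ¬inh → ¬empty λ z z∈y → ¬inh (z , z∈y))
                               (λ (z , z∈y) empty → empty z z∈y)
                               (∁-set (all-set (∅-set x)))

module SmallSetClosure (em : ExcludedMiddle) {M : Set} (_∈_ : M → M → Set)
  (complements : Complements _∈_) (pairing : Pairing _∈_) (setUnion : SetUnion _∈_)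
  (preproduct : Preproduct _∈_) (frege : Frege1* _∈_)
  (intersections : IntersectionRelSet _∈_) where
  open Classes _∈_
  open Classical em _∈_
  open BooleanClosure em _∈_ complements pairing setUnion
  open PreproductClosure em _∈_ complements pairing setUnion preproduct

  private variable
    P Q T : M → Set
    W : M

  atMostOne-set : IsSet AtMostOne
  atMostOne-set = frege

  hasCommonElement-set : IsSet HasCommonElement
  hasCommonElement-set = intersections

  singleton-atMostOne : ∀ a → AtMostOne (set (singleton-set a))
  singleton-atMostOne a = a , λ _ → ∈-set⁻ (singleton-set a)

  atMostTwo-set : IsSet AtMostTwo
  atMostTwo-set = IsSet-resp from-covered to-covered (coveredBy-set atMostOne-set atMostOne-set)
    where
      from-covered : ∀ {y} → CoveredBy AtMostOne AtMostOne y → AtMostTwo y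
      from-covered (_ , _ , (p , r⊆p) , (q , s⊆q) , y⊆sr) =
        p , q , λ z z∈y → [ inj₂ ∘ s⊆q z , inj₁ ∘ r⊆p z ]′ (y⊆sr z z∈y)
      to-covered : ∀ {y} → AtMostTwo y → CoveredBy AtMostOne AtMostOne y
      to-covered (p , q , y⊆pq) =
        set (singleton-set p) , set (singleton-set q) , singleton-atMostOne p , singleton-atMostOne q ,
        λ z z∈y → [ inj₂ ∘ ∈-set⁺ (singleton-set p) , inj₁ ∘ ∈-set⁺ (singleton-set q) ]′
                    (y⊆pq z z∈y)

  withinOne-set : IsSet P → IsSet (WithinOne P)
  withinOne-set {P} A = IsSet-resp from-subset to-subset
    (subsetOf-set (∩-set atMostOne-set (∩-set (inhabited-set (set A)) (all-set A))))
    where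
      from-subset : ∀ {v} → SubsetOf (AtMostOne ∩ Inhabited ∩ All P) v → WithinOne P v
      from-subset (a , ((_ , a⊆z) , (w , w∈a) , a⊆P) , v⊆a) =
        w , a⊆P w w∈a , λ m m∈v → trans (a⊆z m (v⊆a m m∈v)) (sym (a⊆z w w∈a))
      to-subset : ∀ {v} → WithinOne P v → SubsetOf (AtMostOne ∩ Inhabited ∩ All P) v
      to-subset (z , Pz , v⊆z) =
        set ⟦z⟧ ,
        (singleton-atMostOne z , (z , ∈-set⁺ ⟦z⟧ refl) ,
         λ m m∈z → subst P (sym (∈-set⁻ ⟦z⟧ m∈z)) Pz) ,
        λ m m∈v → ∈-set⁺ ⟦z⟧ (v⊆z m m∈v)
        where
          ⟦z⟧ : IsSet (_≡ z)
          ⟦z⟧ = singleton-set z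

  withinTriple-set : IsSet P → IsSet Q → IsSet T → IsSet (WithinTriple P Q T)
  withinTriple-set {P} {Q} {T} A B C = IsSet-resp from-covered to-covered
    (coveredBy-set (coveredBy-set (withinOne-set A) (withinOne-set B)) (withinOne-set C))
    where
      Covered : M → Set
      Covered = CoveredBy (CoveredBy (WithinOne P) (WithinOne Q)) (WithinOne T)
      from-covered : ∀ {W} → Covered W → WithinTriple P Q T W
      from-covered (_ , _ , (_ , _ , (g , Pg , v⊆g) , (r , Qr , w⊆r) , t⊆wv) , (s , Ts , u⊆s) , W⊆ut) =
        g , r , s , Pg , Qr , Ts , λ x x∈W →
        [ inj₂ ∘ inj₂ ∘ u⊆s x , [ inj₂ ∘ inj₁ ∘ w⊆r x , inj₁ ∘ v⊆g x ]′ ∘ t⊆wv x ]′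
        (W⊆ut x x∈W)
      to-covered : ∀ {W} → WithinTriple P Q T W → Covered W
      to-covered (g , r , s , Pg , Qr , Ts , W⊆grs) =
        set (pair-set g r) , set (singleton-set s) ,
        (set (singleton-set g) , set (singleton-set r) ,
          (g , Pg , λ _ → ∈-set⁻ (singleton-set g)) , (r , Qr , λ _ → ∈-set⁻ (singleton-set r)) ,
          λ x x∈gr → [ inj₂ ∘ ∈-set⁺ (singleton-set g) , inj₁ ∘ ∈-set⁺ (singleton-set r) ]′
                       (∈-set⁻ (pair-set g r) x∈gr)) ,
        (s , Ts , λ _ → ∈-set⁻ (singleton-set s)) ,
        λ x x∈W → oneOf⇒∈singleton⊎∈pair (W⊆grs x x∈W)

  -- Without extensionality y ≈ a is expressed through y ⊆ a: as a has at most two members, a subset of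
  -- a is all of a if it is not a subsingleton, or if it is inhabited and a is a subsingleton.
  saturation-set : IsSet P → (∀ {a} → P a → AtMostTwo a × Inhabited a) → IsSet (Saturation P)
  saturation-set {P} A small = IsSet-resp from-cases to-cases
    (∪-set (∩-set (subsetOf-set (∩-set A (∁-set atMostOne-set))) (∁-set atMostOne-set))
           (∩-set (subsetOf-set (∩-set A atMostOne-set)) (inhabited-set (set A))))
    where
      Cases : M → Set
      Cases = (SubsetOf (P ∩ ∁ AtMostOne) ∩ ∁ AtMostOne) ∪ (SubsetOf (P ∩ AtMostOne) ∩ Inhabited)
      from-cases : ∀ {y} → Cases y → Saturation P y
      from-cases (inj₁ ((a , (Pa , _) , y⊆a) , ¬y₁)) =
        a , Pa , ⊆-antisym y⊆a (atMostTwo-⊇ (proj₁ (small Pa)) y⊆a ¬y₁)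
      from-cases (inj₂ ((a , (Pa , a₁) , y⊆a) , y-inhabited)) =
        a , Pa , ⊆-antisym y⊆a (atMostOne-⊇ a₁ y⊆a y-inhabited)
      to-cases : ∀ {y} → Saturation P y → Cases y
      to-cases (a , Pa , y≈a) with em (AtMostOne a)
      ... | inj₁ a₁ =
        inj₂ ((a , (Pa , a₁) , ≈⇒⊆ y≈a) , inhabited-⊆ (≈⇒⊆ (≈-sym y≈a)) (proj₂ (small Pa)))
      ... | inj₂ ¬a₁ =
        inj₁ ((a , (Pa , ¬a₁) , ≈⇒⊆ y≈a) , ¬a₁ ∘ atMostOne-⊆ (≈⇒⊆ (≈-sym y≈a)))

  meetsSome-set : IsSet P → IsSet (MeetsSome P)
  meetsSome-set {P} A = IsSet-resp from-⋃ to-⋃ (⋃-set (∩-set hasCommonElement-set (any-set A)))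
    where
      from-⋃ : ∀ {y} → ∃[ m ] ((HasCommonElement ∩ Any P) m × y ∈ m) → MeetsSome P y
      from-⋃ (_ , ((z , z∈all) , (b , b∈m , Pb)) , y∈m) = b , Pb , z , z∈all _ y∈m , z∈all _ b∈m
      to-⋃ : ∀ {y} → MeetsSome P y → ∃[ m ] ((HasCommonElement ∩ Any P) m × y ∈ m)
      to-⋃ {y} (b , Pb , y-meets-b) =
        set (pair-set y b) ,
        (Equivalence.from (pair-hasCommonElement y-b) y-meets-b , (b , pair-∈ʳ y-b , Pb)) ,
        pair-∈ˡ y-b
        where
          y-b : Pair (set (pair-set y b)) y b
          y-b = proj₂ (pair-set y b)

  disjointSplit-set : IsSet DisjointSplit
  disjointSplit-set = coveredBy-set (∩-set atMostTwo-set (∁-set hasCommonElement-set)) atMostOne-set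

  ¬disjointSplit⇒meets : ∀ {p q t} → ¬ DisjointSplit W → All (OneOf p q t) W → p meets q
  ¬disjointSplit⇒meets {p = p} {q} {t} ¬split W⊆pqt = dne λ ¬pq → ¬split
    (set (pair-set p q) , set (singleton-set t) ,
     (pair⇒atMostTwo p-q , ¬pq ∘ Equivalence.to (pair-hasCommonElement p-q)) ,
     singleton-atMostOne t ,
     λ x x∈W → oneOf⇒∈singleton⊎∈pair (W⊆pqt x x∈W))
    where
      p-q : Pair (set (pair-set p q)) p q
      p-q = proj₂ (pair-set p q)

module RelativeProducts (em : ExcludedMiddle) {M : Set} (_∈_ : M → M → Set)
  (complements : Complements _∈_) (pairing : Pairing _∈_) (setUnion : SetUnion _∈_)
  (preproduct : Preproduct _∈_) (frege : Frege1* _∈_)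
  (intersections : IntersectionRelSet _∈_) where
  open Classes _∈_
  open Classical em _∈_
  open BooleanClosure em _∈_ complements pairing setUnion
  open PreproductClosure em _∈_ complements pairing setUnion preproduct
  open SmallSetClosure em _∈_ complements pairing setUnion preproduct frege intersections

  private variable
    C : M → Set
    a b c r s y R S : M

  RelativeProduct : M → M → M → Set
  RelativeProduct R S y =
    ∃[ a ] ∃[ b ] ∃[ c ] ∃[ r ] ∃[ s ] (Pair y a c × r ∈ R × s ∈ S × Pair r a b × Pair s b c)

  relativeProduct-swap : RelativeProduct R S y → RelativeProduct S R y
  relativeProduct-swap (a , b , c , r , s , y-ac , r∈R , s∈S , r-ab , s-bc) =
    c , b , a , s , r , pair-sym y-ac , s∈S , r∈R , pair-sym s-bc , pair-sym r-ab

  Triangle : (M → Set) → M → M → M → Set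
  Triangle C R S = WithinTriple (C ∩ AtMostTwo) ((_∈ R) ∩ AtMostTwo) ((_∈ S) ∩ AtMostTwo)
                 ∩ ∁ DisjointSplit ∩ ∁ HasCommonElement

  InTriangle : (M → Set) → M → M → M → Set
  InTriangle C R S y = C y × ∃[ W ] (Triangle C R S W × y ∈ W)

  inTriangle-set : IsSet C → ∀ R S → IsSet (InTriangle C R S)
  inTriangle-set A R S = ∩-set A (⋃-set (∩-set
    (withinTriple-set (∩-set A atMostTwo-set) (∩-set (isSet-∈ R) atMostTwo-set)
                      (∩-set (isSet-∈ S) atMostTwo-set))
    (∩-set (∁-set disjointSplit-set) (∁-set hasCommonElement-set))))

  -- If y is the vertex r or s rather than g, then g takes over its role, as the cell hypotheses allow.
  inTriangle⇒relativeProduct : (∀ {x y} → C x → C y → x ∈ R → y ∈ R) →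
    (∀ {x y} → C x → C y → x ∈ S → y ∈ S) → InTriangle C R S y → RelativeProduct R S y
  inTriangle⇒relativeProduct {C} {R} {S} {y} cellR cellS
    (Cy , W , ((g , r , s , (Cg , g₂) , (r∈R , r₂) , (s∈S , s₂) , W⊆grs) , ¬split , ¬common) , y∈W)
    with triangle g₂ r₂ s₂ noCommon
           (¬disjointSplit⇒meets ¬split W⊆grs)
           (¬disjointSplit⇒meets ¬split (λ x → oneOf-rotate ∘ W⊆grs x))
           (¬disjointSplit⇒meets ¬split (λ x → oneOf-rotate ∘ oneOf-rotate ∘ W⊆grs x))
       | W⊆grs y y∈W
    where
      noCommon : ∀ z → z ∈ g → z ∈ r → z ∈ s → ⊥
      noCommon z z∈g z∈r z∈s = ¬common (z , λ m m∈W → oneOf-elim z∈g z∈r z∈s (W⊆grs m m∈W))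
  ... | a , b , c , g-ac , r-ab , s-bc | inj₁ refl =
    a , b , c , r , s , g-ac , r∈R , s∈S , r-ab , s-bc
  ... | a , b , c , g-ac , r-ab , s-bc | inj₂ (inj₁ refl) =
    a , c , b , g , s , r-ab , cellR Cy Cg r∈R , s∈S , g-ac , pair-sym s-bc
  ... | a , b , c , g-ac , r-ab , s-bc | inj₂ (inj₂ refl) =
    b , a , c , r , g , s-bc , r∈R , cellS Cy Cg s∈S , pair-sym r-ab , g-ac

  inTriangle-intro : C y → r ∈ R → s ∈ S → Pair y a c → Pair r a b → Pair s b c →
    ¬ a ≡ b → ¬ b ≡ c → ¬ a ≡ c → InTriangle C R S y
  inTriangle-intro {y = y} {r = r} {s = s} {a = a} {c = c} {b = b}
    Cy r∈R s∈S y-ac r-ab s-bc a≢b b≢c a≢c =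
    Cy , set T ,
    ((y , r , s , (Cy , pair⇒atMostTwo y-ac) , (r∈R , pair⇒atMostTwo r-ab) ,
      (s∈S , pair⇒atMostTwo s-bc) , λ _ → ∈-set⁻ T) ,
     pairwiseMeeting⇒¬disjointSplit y∈T r∈T s∈T y≢r r≢s y≢s
       (a , pair-∈ˡ y-ac , pair-∈ˡ r-ab) (b , pair-∈ʳ r-ab , pair-∈ˡ s-bc)
       (c , pair-∈ʳ y-ac , pair-∈ʳ s-bc) ,
     λ (z , z∈all) → triangle-¬common y-ac r-ab s-bc a≢b b≢c a≢c
                       (z∈all y y∈T) (z∈all r r∈T) (z∈all s s∈T)) ,
    y∈T
    where
      T : IsSet (OneOf y r s)
      T = oneOf-set y r s
      y∈T : y ∈ set T
      y∈T = ∈-set⁺ T (inj₁ refl)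
      r∈T : r ∈ set T
      r∈T = ∈-set⁺ T (inj₂ (inj₁ refl))
      s∈T : s ∈ set T
      s∈T = ∈-set⁺ T (inj₂ (inj₂ refl))
      y≢r : ¬ y ≡ r
      y≢r = ∈∉⇒≢ (pair-∈ʳ y-ac) (pair-∉ r-ab (a≢c ∘ sym) (b≢c ∘ sym))
      r≢s : ¬ r ≡ s
      r≢s = ∈∉⇒≢ (pair-∈ˡ r-ab) (pair-∉ s-bc a≢b a≢c)
      y≢s : ¬ y ≡ s
      y≢s = ∈∉⇒≢ (pair-∈ˡ y-ac) (pair-∉ s-bc a≢b a≢c)

  Cell : M → M → Bool → Bool → M → Set
  Cell R S i j x = Literal i (x ∈ R) × Literal j (x ∈ S)

  Generic : M → M → M → Set
  Generic R S y = ∃[ i ] ∃[ j ] InTriangle (Cell R S i j) R S y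

  generic-set : ∀ R S → IsSet (Generic R S)
  generic-set R S = ∃Bool-set λ i → ∃Bool-set λ j →
    inTriangle-set (∩-set (literal-set i R) (literal-set j S)) R S

  generic⇒relativeProduct : Generic R S y → RelativeProduct R S y
  generic⇒relativeProduct (_ , _ , y-in-triangle) = inTriangle⇒relativeProduct
    (λ Cx Cy → literal-transfer (proj₁ Cx) (proj₁ Cy))
    (λ Cx Cy → literal-transfer (proj₂ Cx) (proj₂ Cy))
    y-in-triangle

  generic-intro : Pair y a c → r ∈ R → s ∈ S → Pair r a b → Pair s b c →
    ¬ a ≡ b → ¬ b ≡ c → ¬ a ≡ c → Generic R S y
  generic-intro {y} {R = R} {S = S} y-ac r∈R s∈S r-ab s-bc a≢b b≢c a≢c
    with literal em (y ∈ R) | literal em (y ∈ S)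
  ... | i , y∈ᵢR | j , y∈ⱼS =
    i , j , inTriangle-intro (y∈ᵢR , y∈ⱼS) r∈R s∈S y-ac r-ab s-bc a≢b b≢c a≢c

  Diagonal : M → M → M → Set
  Diagonal R S =
    AtMostOne ∩ Inhabited ∩ SubsetOf ((_∈ R) ∩ Saturation ((_∈ S) ∩ AtMostTwo ∩ Inhabited))

  diagonal-set : ∀ R S → IsSet (Diagonal R S)
  diagonal-set R S = ∩-set atMostOne-set (∩-set (inhabited-set R) (subsetOf-set (∩-set (isSet-∈ R)
    (saturation-set (∩-set (isSet-∈ S) (∩-set atMostTwo-set (inhabited-set R))) proj₂))))

  diagonal⇒relativeProduct : Diagonal R S y → RelativeProduct R S y
  diagonal⇒relativeProduct (y₁ , (w , w∈y) , (e , (e∈R , (s , (s∈S , s₂ , _) , e≈s)) , y⊆e))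
    with completePair s₂ (≈⇒⊆ e≈s w (y⊆e w w∈y))
  ... | b , s-wb =
    w , b , w , e , s , atMostOne⇒pair y₁ w∈y , e∈R , s∈S , pair-resp-≈ (≈-sym e≈s) s-wb , pair-sym s-wb

  diagonal-intro : Pair y a a → r ∈ R → s ∈ S → Pair r a b → Pair s b a → Diagonal R S y
  diagonal-intro y-aa r∈R s∈S r-ab s-ba =
    pair⇒atMostOne y-aa , (_ , pair-∈ˡ y-aa) ,
    (_ , (r∈R , (_ , (s∈S , pair⇒atMostTwo s-ba , (_ , pair-∈ˡ s-ba)) , pair-≈ r-ab (pair-sym s-ba))) ,
     pair-⊆ y-aa (pair-∈ˡ r-ab) (pair-∈ˡ r-ab))

  Degenerate : M → M → M → Set
  Degenerate R S = Saturation ((_∈ S) ∩ AtMostTwo ∩ MeetsSome ((_∈ R) ∩ AtMostOne))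

  degenerate-set : ∀ R S → IsSet (Degenerate R S)
  degenerate-set R S = saturation-set
    (∩-set (isSet-∈ S) (∩-set atMostTwo-set (meetsSome-set (∩-set (isSet-∈ R) atMostOne-set))))
    λ (_ , s₂ , (_ , _ , z , z∈s , _)) → s₂ , z , z∈s

  degenerate⇒relativeProduct : Degenerate R S y → RelativeProduct R S y
  degenerate⇒relativeProduct (s , (s∈S , s₂ , (r , (r∈R , r₁) , z , z∈s , z∈r)) , y≈s)
    with completePair s₂ z∈s
  ... | c , s-zc =
    z , z , c , r , s , pair-resp-≈ (≈-sym y≈s) s-zc , r∈R , s∈S , atMostOne⇒pair r₁ z∈r , s-zc

  degenerate-intro : Pair y a c → r ∈ R → s ∈ S → Pair r a a → Pair s a c → Degenerate R S y
  degenerate-intro y-ac r∈R s∈S r-aa s-ac =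
    _ , (s∈S , pair⇒atMostTwo s-ac , (_ , (r∈R , pair⇒atMostOne r-aa) , _ , pair-∈ˡ s-ac , pair-∈ˡ r-aa)) ,
    pair-≈ y-ac s-ac

  Pieces : M → M → M → Set
  Pieces R S = Generic R S ∪ Diagonal R S ∪ Degenerate R S ∪ Degenerate S R

  relativeProduct⇒pieces : RelativeProduct R S y → Pieces R S y
  relativeProduct⇒pieces (a , b , c , r , s , y-ac , r∈R , s∈S , r-ab , s-bc)
    with em (a ≡ b) | em (b ≡ c) | em (a ≡ c)
  ... | inj₁ refl | _ | _ = inj₂ (inj₂ (inj₁ (degenerate-intro y-ac r∈R s∈S r-ab s-bc)))
  ... | inj₂ _ | inj₁ refl | _ =
    inj₂ (inj₂ (inj₂ (degenerate-intro (pair-sym y-ac) s∈S r∈R s-bc (pair-sym r-ab))))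
  ... | inj₂ _ | inj₂ _ | inj₁ refl = inj₂ (inj₁ (diagonal-intro y-ac r∈R s∈S r-ab s-bc))
  ... | inj₂ a≢b | inj₂ b≢c | inj₂ a≢c =
    inj₁ (generic-intro y-ac r∈R s∈S r-ab s-bc a≢b b≢c a≢c)

  pieces⇒relativeProduct : Pieces R S y → RelativeProduct R S y
  pieces⇒relativeProduct = [ generic⇒relativeProduct , [ diagonal⇒relativeProduct ,
    [ degenerate⇒relativeProduct , relativeProduct-swap ∘ degenerate⇒relativeProduct ]′ ]′ ]′

  relativeProduct-set : ∀ R S → IsSet (RelativeProduct R S)
  relativeProduct-set R S = IsSet-resp pieces⇒relativeProduct relativeProduct⇒pieces
    (∪-set (generic-set R S) (∪-set (diagonal-set R S) (∪-set (degenerate-set R S) (degenerate-set S R))))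

mainTheorem4 : ExcludedMiddle → (M : Set) (_∈_ : M → M → Set) →
    Complements _∈_ → Pairing _∈_ → SetUnion _∈_ → Frege1* _∈_ →
    Preproduct _∈_ → IntersectionRelSet _∈_ → Composition _∈_
mainTheorem4 em M _∈_ complements pairing setUnion frege preproduct intersections =
  RelativeProducts.relativeProduct-set em _∈_ complements pairing setUnion preproduct frege intersections
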